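{- Let $m\geq 3$ and let $h_1,h_2,h_3$ be positive integers (not necessarily in non-increasing order). An $\mathrm{ROS}(h_1h_2h_3^m)$ exists if and only if $h_1\leq mh_3$, $h_2\leq mh_3$, and $$h_3^2 - \frac{h_3}{m-1}(h_1+h_2) + \frac{2}{m(m-1)}h_1h_2 \geq 0.$$
   Context: Given a sequence $P=(p_1,\dots,p_k)$ of positive integers, an $\mathrm{ROS}(P)$ (symmetric rational outline square respecting $P$) is an assignment of a non-negative rational number $O(i,j,\ell)$ to every multiset $\{i,j,\ell\}$ of elements of $[k]=\{1,\dots,k\}$ (so the value is invariant under permuting $i,j,\ell$) such that $\sum_{\ell\in[k]}O(i,j,\ell)=p_ip_j$ for all $i,j\in[k]$, and $O(i,i,i)=p_i^2$ and $O(i,i,j)=0$ for all $i\neq j$. The notation $h^m$ means $m$ parts equal to $h$; so $(h_1h_2h_3^m)$ is the sequence $(h_1,h_2,h_3,\dots,h_3)$ with $m+2$ entries. -}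

module Defs where

open import Data.Nat as ℕ using (ℕ; zero; suc; _≤_; _∸_; s≤s; z≤n)
open import Data.Integer using (+_)
open import Data.Fin using (Fin; zero; suc)
open import Data.Rational as ℚ using (ℚ; 0ℚ; _/_)
open import Data.Product using (Σ; _×_)
open import Relation.Binary.PropositionalEquality using (_≡_; _≢_)

ℕ→ℚ : ℕ → ℚ
ℕ→ℚ n = + n / 1

∑ : {k : ℕ} → (Fin k → ℚ) → ℚ
∑ {zero}  f = 0ℚ
∑ {suc k} f = f zero ℚ.+ ∑ {k} (λ i → f (suc i))

-- An ROS(P): a symmetric rational outline square respecting P = (p_1,…,p_k).
-- O is a function on triples that is invariant under all permutations of its
-- arguments, i.e. a function on multisets {i,j,ℓ}.
record ROS {k : ℕ} (P : Fin k → ℕ) : Set where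
  field
    O        : Fin k → Fin k → Fin k → ℚ
    sym₁₂    : ∀ i j l → O i j l ≡ O j i l
    sym₂₃    : ∀ i j l → O i j l ≡ O i l j
    nonneg   : ∀ i j l → 0ℚ ℚ.≤ O i j l
    rowSum   : ∀ i j → ∑ (λ l → O i j l) ≡ ℕ→ℚ (P i ℕ.* P j)
    diag     : ∀ i → O i i i ≡ ℕ→ℚ (P i ℕ.* P i)
    offDiag  : ∀ i j → i ≢ j → O i i j ≡ 0ℚ

seq3 : (h₁ h₂ h₃ m : ℕ) → Fin (suc (suc m)) → ℕ
seq3 h₁ h₂ h₃ m zero          = h₁
seq3 h₁ h₂ h₃ m (suc zero)    = h₂
seq3 h₁ h₂ h₃ m (suc (suc _)) = h₃

nz-m-1 : {m : ℕ} → 3 ≤ m → ℕ.NonZero (m ∸ 1)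
nz-m-1 (s≤s (s≤s (s≤s _))) = _

nz-mm-1 : {m : ℕ} → 3 ≤ m → ℕ.NonZero (m ℕ.* (m ∸ 1))
nz-mm-1 (s≤s (s≤s (s≤s _))) = _

{-# OPTIONS --safe #-}
-- Index (h₁ h₂ h₃^m) by A, B and the h₃-block C 0, …, C (m-1).  Summing the
-- row conditions of an ROS over the h₃-block shows that the sums S₁₃₃, S₂₃₃ of
-- O over {A}×C×C and {B}×C×C equal m h₁h₃ - h₁h₂ and m h₂h₃ - h₁h₂, and that
-- the sum S₃₃₃ over C×C×C is m²h₃² - S₁₃₃ - S₂₃₃.  Nonnegativity of S₁₃₃, S₂₃₃
-- gives h₂ ≤ m h₃ and h₁ ≤ m h₃; since S₃₃₃ contains the m diagonal entries
-- h₃², S₃₃₃ - m h₃² = m(m-1)·Q is nonnegative, where Q is the quadratic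
-- expression of the statement.  Conversely, an ROS invariant under permuting
-- the h₃-block is determined by its values x, y, z, w on {A,B,c}, {A,c,d},
-- {B,c,d} and {c,d,e}; its row conditions are four linear equations whose
-- solution x = h₁h₂/m, y = (h₁h₃ - x)/(m-1), z = (h₂h₃ - x)/(m-1),
-- w = Q/(m-2) is nonnegative exactly under the three conditions.
module Submission where

open import Defs
open import Data.Nat as ℕ using (ℕ; _≤_; _∸_)
open import Data.Integer using (+_)
open import Data.Rational as ℚ using (ℚ; 0ℚ; _/_)
open import Data.Product using (_×_)
open import Function.Bundles using (_⇔_)

open import Data.Bool.Base using (if_then_else_)
open import Data.Fin.Base using (Fin; zero; suc; punchIn; punchOut)
open import Data.Fin.Properties using (_≟_; punchInᵢ≢i; punchIn-punchOut; punchIn-injective)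
import Data.Integer.Base as ℤ
import Data.Integer.Properties as ℤP
open import Data.Nat.Base using (zero; suc; NonZero; s≤s)
import Data.Nat.Properties as ℕP
open import Data.Product using (_,_)
open import Data.Rational.Base using (1ℚ; toℚᵘ)
import Data.Rational.Properties as ℚP
open import Data.Rational.Solver using (module +-*-Solver)
open import Data.Rational.Unnormalised.Base as ℚᵘ using (mkℚᵘ; *≡*; *≤*)
import Data.Rational.Unnormalised.Properties as ℚᵘP
open import Function.Base using (_∘_)
open import Function.Bundles using (mk⇔; Equivalence)
open import Relation.Binary.PropositionalEquality
open import Relation.Nullary using (Dec; yes; no; contradiction)
open import Relation.Nullary.Decidable using (does; dec-true; dec-false; does-⇔)

open import Algebra.Properties.CommutativeSemigroup ℕP.+-commutativeSemigroup
  using (xy∙z≈xz∙y; xy∙z≈zy∙x; xy∙z≈yx∙z)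
open import Algebra.Properties.CommutativeMonoid.Sum ℚP.+-0-commutativeMonoid
  using (sum; sum-cong-≗; ∑-distrib-+; sum-remove)
open +-*-Solver using (solve; _:+_; _:-_; _:*_; con; _:=_)

toℚᵘ-/ : ∀ a n → toℚᵘ (+ a / suc n) ℚᵘ.≃ mkℚᵘ (+ a) n
toℚᵘ-/ a n = ℚP.toℚᵘ-fromℚᵘ (mkℚᵘ (+ a) n)

/-*-/ : ∀ a b c d .{{_ : NonZero b}} .{{_ : NonZero d}} →
        (+ a / b) ℚ.* (+ c / d) ≡ (+ (a ℕ.* c) / (b ℕ.* d)) {{ℕP.m*n≢0 b d}}
/-*-/ a (suc b) c (suc d) = ℚP.toℚᵘ-injective (begin
  toℚᵘ ((+ a / suc b) ℚ.* (+ c / suc d))        ≈⟨ ℚP.toℚᵘ-homo-* (+ a / suc b) (+ c / suc d) ⟩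
  toℚᵘ (+ a / suc b) ℚᵘ.* toℚᵘ (+ c / suc d)    ≈⟨ ℚᵘP.*-cong (toℚᵘ-/ a b) (toℚᵘ-/ c d) ⟩
  mkℚᵘ (+ a) b ℚᵘ.* mkℚᵘ (+ c) d               ≡⟨ cong (λ i → mkℚᵘ i _) (ℤP.pos-* a c) ⟨
  mkℚᵘ (+ (a ℕ.* c)) _                          ≈⟨ toℚᵘ-/ (a ℕ.* c) _ ⟨
  toℚᵘ (+ (a ℕ.* c) / (suc b ℕ.* suc d))        ∎)
  where open ℚᵘP.≃-Reasoning

/-cross : ∀ a b c d .{{_ : NonZero b}} .{{_ : NonZero d}} →
          a ℕ.* d ≡ c ℕ.* b → + a / b ≡ + c / d
/-cross a (suc b) c (suc d) ad≡cb = ℚP.fromℚᵘ-cong {mkℚᵘ (+ a) b} {mkℚᵘ (+ c) d} (*≡* (begin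
  + a ℤ.* + suc d   ≡⟨ ℤP.pos-* a (suc d) ⟨
  + (a ℕ.* suc d)   ≡⟨ cong +_ ad≡cb ⟩
  + (c ℕ.* suc b)   ≡⟨ ℤP.pos-* c (suc b) ⟩
  + c ℤ.* + suc b   ∎))
  where open ≡-Reasoning

ℕ→ℚ-+ : ∀ a b → ℕ→ℚ (a ℕ.+ b) ≡ ℕ→ℚ a ℚ.+ ℕ→ℚ b
ℕ→ℚ-+ a b = ℚP.toℚᵘ-injective (begin
  toℚᵘ (ℕ→ℚ (a ℕ.+ b))               ≈⟨ toℚᵘ-/ (a ℕ.+ b) 0 ⟩
  mkℚᵘ (+ (a ℕ.+ b)) 0               ≡⟨ cong (λ i → mkℚᵘ i 0) numerator ⟩
  mkℚᵘ (+ a) 0 ℚᵘ.+ mkℚᵘ (+ b) 0     ≈⟨ ℚᵘP.+-cong (toℚᵘ-/ a 0) (toℚᵘ-/ b 0) ⟨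
  toℚᵘ (ℕ→ℚ a) ℚᵘ.+ toℚᵘ (ℕ→ℚ b)     ≈⟨ ℚP.toℚᵘ-homo-+ (ℕ→ℚ a) (ℕ→ℚ b) ⟨
  toℚᵘ (ℕ→ℚ a ℚ.+ ℕ→ℚ b)             ∎)
  where
  open ℚᵘP.≃-Reasoning
  numerator : + (a ℕ.+ b) ≡ + a ℤ.* + 1 ℤ.+ + b ℤ.* + 1
  numerator = trans (ℤP.pos-+ a b) (sym (cong₂ ℤ._+_ (ℤP.*-identityʳ (+ a)) (ℤP.*-identityʳ (+ b))))

ℕ→ℚ-* : ∀ a b → ℕ→ℚ (a ℕ.* b) ≡ ℕ→ℚ a ℚ.* ℕ→ℚ b
ℕ→ℚ-* a b = sym (/-*-/ a 1 b 1)

ℕ→ℚ-mono-≤ : ∀ {a b} → a ≤ b → ℕ→ℚ a ℚ.≤ ℕ→ℚ b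
ℕ→ℚ-mono-≤ {a} {b} a≤b = ℚP.toℚᵘ-cancel-≤
  (ℚᵘP.≤-respˡ-≃ (ℚᵘP.≃-sym (toℚᵘ-/ a 0)) (ℚᵘP.≤-respʳ-≃ (ℚᵘP.≃-sym (toℚᵘ-/ b 0))
    (*≤* (subst₂ ℤ._≤_ (sym (ℤP.*-identityʳ (+ a))) (sym (ℤP.*-identityʳ (+ b))) (ℤ.+≤+ a≤b)))))

ℕ→ℚ-cancel-≤ : ∀ {a b} → ℕ→ℚ a ℚ.≤ ℕ→ℚ b → a ≤ b
ℕ→ℚ-cancel-≤ {a} {b} a≤b = ℤP.drop‿+≤+
  (subst₂ ℤ._≤_ (ℤP.*-identityʳ (+ a)) (ℤP.*-identityʳ (+ b)) (ℚᵘP.drop-*≤*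
    (ℚᵘP.≤-respˡ-≃ (toℚᵘ-/ a 0) (ℚᵘP.≤-respʳ-≃ (toℚᵘ-/ b 0) (ℚP.toℚᵘ-mono-≤ a≤b)))))

ℕ→ℚ-suc : ∀ n → ℕ→ℚ (suc n) ≡ 1ℚ ℚ.+ ℕ→ℚ n
ℕ→ℚ-suc = ℕ→ℚ-+ 1

ℕ→ℚ-nonNeg : ∀ a → 0ℚ ℚ.≤ ℕ→ℚ a
ℕ→ℚ-nonNeg a = ℚP.nonNegative⁻¹ (ℕ→ℚ a) {{ℚP.normalize-nonNeg a 1}}

/-split : ∀ a d .{{_ : NonZero d}} → + a / d ≡ ℕ→ℚ a ℚ.* (+ 1 / d)
/-split a d@(suc _) = sym (trans (/-*-/ a 1 1 d) (/-cross (a ℕ.* 1) (1 ℕ.* d) a d (ℕP.*-assoc a 1 d)))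

1/-* : ∀ a b .{{_ : NonZero a}} .{{_ : NonZero b}} →
       (+ 1 / (a ℕ.* b)) {{ℕP.m*n≢0 a b}} ≡ (+ 1 / a) ℚ.* (+ 1 / b)
1/-* a b = sym (/-*-/ 1 a 1 b)

*-1/-cancel : ∀ d .{{_ : NonZero d}} q → ℕ→ℚ d ℚ.* (q ℚ.* (+ 1 / d)) ≡ q
*-1/-cancel d@(suc _) q = begin
  ℕ→ℚ d ℚ.* (q ℚ.* (+ 1 / d))   ≡⟨ ℚP.*-comm (ℕ→ℚ d) _ ⟩
  q ℚ.* (+ 1 / d) ℚ.* ℕ→ℚ d     ≡⟨ ℚP.*-assoc q _ _ ⟩
  q ℚ.* ((+ 1 / d) ℚ.* ℕ→ℚ d)   ≡⟨ cong (q ℚ.*_) 1/d*d≡1 ⟩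
  q ℚ.* 1ℚ                      ≡⟨ ℚP.*-identityʳ q ⟩
  q                             ∎
  where
  open ≡-Reasoning
  1/d*d≡1 : (+ 1 / d) ℚ.* ℕ→ℚ d ≡ 1ℚ
  1/d*d≡1 = trans (/-*-/ 1 d d 1) (/-cross (1 ℕ.* d) (d ℕ.* 1) 1 1 (ℕP.*-assoc 1 d 1))

p≤p+q : ∀ {p q} → 0ℚ ℚ.≤ q → p ℚ.≤ p ℚ.+ q
p≤p+q {p} 0≤q = subst (ℚ._≤ p ℚ.+ _) (ℚP.+-identityʳ p) (ℚP.+-monoʳ-≤ p 0≤q)

p≤q⇒p≤r+q : ∀ {p q r} → 0ℚ ℚ.≤ r → p ℚ.≤ q → p ℚ.≤ r ℚ.+ q
p≤q⇒p≤r+q {p} 0≤r p≤q = subst (ℚ._≤ _) (ℚP.+-identityˡ p) (ℚP.+-mono-≤ 0≤r p≤q)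

0+[0+p]≡p : ∀ p → 0ℚ ℚ.+ (0ℚ ℚ.+ p) ≡ p
0+[0+p]≡p p = trans (ℚP.+-identityˡ (0ℚ ℚ.+ p)) (ℚP.+-identityˡ p)

p≤q⇒0≤q-p : ∀ {p q} → p ℚ.≤ q → 0ℚ ℚ.≤ q ℚ.- p
p≤q⇒0≤q-p {p} {q} p≤q = subst (ℚ._≤ q ℚ.- p) (ℚP.+-inverseʳ p) (ℚP.+-monoˡ-≤ (ℚ.- p) p≤q)

0≤[1+n]*q⇒0≤q : ∀ n {q} → 0ℚ ℚ.≤ ℕ→ℚ (suc n) ℚ.* q → 0ℚ ℚ.≤ q
0≤[1+n]*q⇒0≤q n {q} 0≤nq = ℚP.*-cancelˡ-≤-pos (ℕ→ℚ (suc n)) {{ℚP.normalize-pos (suc n) 1}}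
  (subst (ℚ._≤ ℕ→ℚ (suc n) ℚ.* q) (sym (ℚP.*-zeroʳ (ℕ→ℚ (suc n)))) 0≤nq)

p+q≡r⇒q≡r-p : ∀ {p q r} → p ℚ.+ q ≡ r → q ≡ r ℚ.- p
p+q≡r⇒q≡r-p {p} {q} refl = solve 2 (λ p q → q := (p :+ q) :- p) refl p q

≤⇔ℕ→ℚ-scaled : ∀ a b c m → 0 ℕ.< a →
               b ≤ m ℕ.* c ⇔ ℕ→ℚ (a ℕ.* b) ℚ.≤ ℕ→ℚ m ℚ.* ℕ→ℚ (a ℕ.* c)
≤⇔ℕ→ℚ-scaled a b c m 0<a = mk⇔
  (λ b≤mc → subst (ℕ→ℚ (a ℕ.* b) ℚ.≤_) (ℕ→ℚ-* m (a ℕ.* c))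
              (ℕ→ℚ-mono-≤ (subst (a ℕ.* b ≤_) a[mc]≡m[ac] (ℕP.*-monoʳ-≤ a b≤mc))))
  (λ ab≤mac → ℕP.*-cancelˡ-≤ a {{ℕ.>-nonZero 0<a}} (subst (a ℕ.* b ≤_) (sym a[mc]≡m[ac])
              (ℕ→ℚ-cancel-≤ (subst (ℕ→ℚ (a ℕ.* b) ℚ.≤_) (sym (ℕ→ℚ-* m (a ℕ.* c))) ab≤mac))))
  where
  a[mc]≡m[ac] : a ℕ.* (m ℕ.* c) ≡ m ℕ.* (a ℕ.* c)
  a[mc]≡m[ac] = trans (sym (ℕP.*-assoc a m c)) (trans (cong (ℕ._* c) (ℕP.*-comm a m)) (ℕP.*-assoc m a c))

≤⇔ℕ→ℚ-scaled′ : ∀ a b c m → 0 ℕ.< b →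
                a ≤ m ℕ.* c ⇔ ℕ→ℚ (a ℕ.* b) ℚ.≤ ℕ→ℚ m ℚ.* ℕ→ℚ (b ℕ.* c)
≤⇔ℕ→ℚ-scaled′ a b c m 0<b =
  subst (λ t → a ≤ m ℕ.* c ⇔ ℕ→ℚ t ℚ.≤ ℕ→ℚ m ℚ.* ℕ→ℚ (b ℕ.* c)) (ℕP.*-comm b a) (≤⇔ℕ→ℚ-scaled b a c m 0<b)

∑≡sum : ∀ {n} (f : Fin n → ℚ) → ∑ f ≡ sum f
∑≡sum {zero}  f = refl
∑≡sum {suc n} f = cong (f zero ℚ.+_) (∑≡sum (f ∘ suc))

sum-const : ∀ n v → sum {n} (λ _ → v) ≡ ℕ→ℚ n ℚ.* v
sum-const zero    v = sym (ℚP.*-zeroˡ v)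
sum-const (suc n) v = begin
  v ℚ.+ sum {n} (λ _ → v)     ≡⟨ cong (v ℚ.+_) (sum-const n v) ⟩
  v ℚ.+ ℕ→ℚ n ℚ.* v           ≡⟨ v+av≡[1+a]v v (ℕ→ℚ n) ⟩
  (1ℚ ℚ.+ ℕ→ℚ n) ℚ.* v        ≡⟨ cong (ℚ._* v) (ℕ→ℚ-suc n) ⟨
  ℕ→ℚ (suc n) ℚ.* v           ∎
  where
  open ≡-Reasoning
  v+av≡[1+a]v : ∀ v a → v ℚ.+ a ℚ.* v ≡ (1ℚ ℚ.+ a) ℚ.* v
  v+av≡[1+a]v = solve 2 (λ v a → v :+ a :* v := (con 1ℚ :+ a) :* v) refl

sum-nonNeg : ∀ {n} {f : Fin n → ℚ} → (∀ i → 0ℚ ℚ.≤ f i) → 0ℚ ℚ.≤ sum f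
sum-nonNeg {zero}  f≥0 = ℚP.≤-refl
sum-nonNeg {suc n} f≥0 = ℚP.+-mono-≤ (f≥0 zero) (sum-nonNeg (f≥0 ∘ suc))

sum-mono-≤ : ∀ {n} {f g : Fin n → ℚ} → (∀ i → f i ℚ.≤ g i) → sum f ℚ.≤ sum g
sum-mono-≤ {zero}  f≤g = ℚP.≤-refl
sum-mono-≤ {suc n} f≤g = ℚP.+-mono-≤ (f≤g zero) (sum-mono-≤ (f≤g ∘ suc))

term≤sum : ∀ {n} {f : Fin n → ℚ} → (∀ i → 0ℚ ℚ.≤ f i) → ∀ i → f i ℚ.≤ sum f
term≤sum f≥0 zero    = p≤p+q (sum-nonNeg (f≥0 ∘ suc))
term≤sum f≥0 (suc i) = p≤q⇒p≤r+q (f≥0 zero) (term≤sum (f≥0 ∘ suc) i)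

∑-distrib-+₃ : ∀ {n} (f g h : Fin n → ℚ) →
               sum (λ i → f i ℚ.+ (g i ℚ.+ h i)) ≡ sum f ℚ.+ (sum g ℚ.+ sum h)
∑-distrib-+₃ f g h = trans (∑-distrib-+ f _) (cong (sum f ℚ.+_) (∑-distrib-+ g h))

sum-constExcept : ∀ {n} (f : Fin (suc n) → ℚ) i {v} → (∀ j → j ≢ i → f j ≡ v) →
                  sum f ≡ f i ℚ.+ ℕ→ℚ n ℚ.* v
sum-constExcept {n} f i {v} f≡v = begin
  sum f                                 ≡⟨ sum-remove f ⟩
  f i ℚ.+ sum (λ j → f (punchIn i j))   ≡⟨ cong (f i ℚ.+_) (sum-cong-≗ (λ j → f≡v _ (punchInᵢ≢i i j))) ⟩
  f i ℚ.+ sum {n} (λ _ → v)             ≡⟨ cong (f i ℚ.+_) (sum-const n v) ⟩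
  f i ℚ.+ ℕ→ℚ n ℚ.* v                   ∎
  where open ≡-Reasoning

sum-constExcept₂ : ∀ {n} (f : Fin (suc (suc n)) → ℚ) {i j v} → i ≢ j →
                   (∀ l → l ≢ i → l ≢ j → f l ≡ v) → sum f ≡ f i ℚ.+ (f j ℚ.+ ℕ→ℚ n ℚ.* v)
sum-constExcept₂ {n} f {i} {j} {v} i≢j f≡v = begin
  sum f                                                 ≡⟨ sum-remove f ⟩
  f i ℚ.+ sum (λ l → f (punchIn i l))                   ≡⟨ cong (f i ℚ.+_) (sum-constExcept _ (punchOut i≢j) rest≡v) ⟩
  f i ℚ.+ (f (punchIn i (punchOut i≢j)) ℚ.+ nv)        ≡⟨ cong (λ l → f i ℚ.+ (f l ℚ.+ nv)) (punchIn-punchOut i≢j) ⟩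
  f i ℚ.+ (f j ℚ.+ nv)                                  ∎
  where
  open ≡-Reasoning
  nv : ℚ
  nv = ℕ→ℚ n ℚ.* v
  rest≡v : ∀ l → l ≢ punchOut i≢j → f (punchIn i l) ≡ v
  rest≡v l l≢j′ = f≡v _ (punchInᵢ≢i i l)
    (λ eq → l≢j′ (punchIn-injective i l _ (trans eq (sym (punchIn-punchOut i≢j)))))

module SymmetricArray {k} {O : Fin k → Fin k → Fin k → ℚ}
  (sym₁₂ : ∀ i j l → O i j l ≡ O j i l) (sym₂₃ : ∀ i j l → O i j l ≡ O i l j)
  (offDiag : ∀ i j → i ≢ j → O i i j ≡ 0ℚ) where

  rotate : ∀ i j l → O i j l ≡ O j l i
  rotate i j l = trans (sym₁₂ i j l) (sym₂₃ j i l)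

  O-iji≡0 : ∀ i j → i ≢ j → O i j i ≡ 0ℚ
  O-iji≡0 i j i≢j = trans (sym₂₃ i j i) (offDiag i j i≢j)

  O-ijj≡0 : ∀ i j → i ≢ j → O i j j ≡ 0ℚ
  O-ijj≡0 i j i≢j = trans (rotate i j j) (offDiag j i (≢-sym i≢j))

δ : ∀ {k} → Fin k → Fin k → ℕ
δ i j = if does (i ≟ j) then 1 else 0

δ-refl : ∀ {k} (i : Fin k) → δ i i ≡ 1
δ-refl i = cong (if_then 1 else 0) (dec-true (i ≟ i) refl)

δ-≢ : ∀ {k} {i j : Fin k} → i ≢ j → δ i j ≡ 0
δ-≢ {i = i} {j} i≢j = cong (if_then 1 else 0) (dec-false (i ≟ j) i≢j)

δ-sym : ∀ {k} (i j : Fin k) → δ i j ≡ δ j i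
δ-sym i j = cong (if_then 1 else 0) (does-⇔ (mk⇔ sym sym) (i ≟ j) (j ≟ i))

coincidences : ∀ {k} → Fin k → Fin k → Fin k → ℕ
coincidences i j l = δ i j ℕ.+ δ j l ℕ.+ δ i l

occurrences : ∀ {k} → Fin k → Fin k → Fin k → Fin k → ℕ
occurrences p i j l = δ p i ℕ.+ δ p j ℕ.+ δ p l

coincidences-swap₁₂ : ∀ {k} (i j l : Fin k) → coincidences i j l ≡ coincidences j i l
coincidences-swap₁₂ i j l = trans (xy∙z≈xz∙y (δ i j) (δ j l) (δ i l))
  (cong (λ t → t ℕ.+ δ i l ℕ.+ δ j l) (δ-sym i j))

coincidences-swap₂₃ : ∀ {k} (i j l : Fin k) → coincidences i j l ≡ coincidences i l j
coincidences-swap₂₃ i j l = trans (xy∙z≈zy∙x (δ i j) (δ j l) (δ i l))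
  (cong (λ t → δ i l ℕ.+ t ℕ.+ δ i j) (δ-sym j l))

occurrences-swap₁₂ : ∀ {k} (p i j l : Fin k) → occurrences p i j l ≡ occurrences p j i l
occurrences-swap₁₂ p i j l = xy∙z≈yx∙z (δ p i) (δ p j) (δ p l)

occurrences-swap₂₃ : ∀ {k} (p i j l : Fin k) → occurrences p i j l ≡ occurrences p i l j
occurrences-swap₂₃ p i j l = xy∙z≈xz∙y (δ p i) (δ p j) (δ p l)

coincidences-iii : ∀ {k} (i : Fin k) → coincidences i i i ≡ 3
coincidences-iii i = cong (λ t → t ℕ.+ t ℕ.+ t) (δ-refl i)

coincidences-iij : ∀ {k} {i j : Fin k} → i ≢ j → coincidences i i j ≡ 1
coincidences-iij {i = i} i≢j = cong₂ (λ s t → s ℕ.+ t ℕ.+ t) (δ-refl i) (δ-≢ i≢j)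

coincidences-distinct : ∀ {k} {i j l : Fin k} → i ≢ j → j ≢ l → i ≢ l → coincidences i j l ≡ 0
coincidences-distinct i≢j j≢l i≢l = cong₂ ℕ._+_ (cong₂ ℕ._+_ (δ-≢ i≢j) (δ-≢ j≢l)) (δ-≢ i≢l)

-- A triple of indices has 0, 1 or 3 coinciding pairs.
data Shape : Set where
  allDistinct onePair allEqual : Shape

shape : ℕ → Shape
shape 0 = allDistinct
shape 3 = allEqual
shape _ = onePair

pattern A   = zero
pattern B   = suc zero
pattern C c = suc (suc c)

-- The row conditions of the ROS(h₁ h₂ h₃^(n+2)) that is x on {A, B, C c}, y on
-- {A, C c, C d}, z on {B, C c, C d} and w on {C c, C d, C e} for distinct c, d, e.
record SymmetricSolution (n h₁ h₂ h₃ : ℕ) : Set where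
  field
    x y z w : ℚ
    x≥0 : 0ℚ ℚ.≤ x
    y≥0 : 0ℚ ℚ.≤ y
    z≥0 : 0ℚ ℚ.≤ z
    w≥0 : 0ℚ ℚ.≤ w
    row₁₂ : ℕ→ℚ (suc (suc n)) ℚ.* x ≡ ℕ→ℚ (h₁ ℕ.* h₂)
    row₁₃ : x ℚ.+ ℕ→ℚ (suc n) ℚ.* y ≡ ℕ→ℚ (h₁ ℕ.* h₃)
    row₂₃ : x ℚ.+ ℕ→ℚ (suc n) ℚ.* z ≡ ℕ→ℚ (h₂ ℕ.* h₃)
    row₃₃ : y ℚ.+ (z ℚ.+ ℕ→ℚ n ℚ.* w) ≡ ℕ→ℚ (h₃ ℕ.* h₃)

module SymmetricConstruction {n h₁ h₂ h₃ : ℕ} (s : SymmetricSolution n h₁ h₂ h₃) where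
  open SymmetricSolution s

  m : ℕ
  m = suc (suc n)

  P : Fin (suc (suc m)) → ℕ
  P = seq3 h₁ h₂ h₃ m

  -- The value on a multiset of the given shape containing A and B the given numbers of times.
  weight : Shape → ℕ → ℕ → ℚ
  weight allDistinct (suc _) (suc _) = x
  weight allDistinct (suc _) zero    = y
  weight allDistinct zero    (suc _) = z
  weight allDistinct zero    zero    = w
  weight onePair     _       _       = 0ℚ
  weight allEqual    (suc _) _       = ℕ→ℚ (h₁ ℕ.* h₁)
  weight allEqual    zero    (suc _) = ℕ→ℚ (h₂ ℕ.* h₂)
  weight allEqual    zero    zero    = ℕ→ℚ (h₃ ℕ.* h₃)

  weight-nonNeg : ∀ σ a b → 0ℚ ℚ.≤ weight σ a b
  weight-nonNeg allDistinct (suc _) (suc _) = x≥0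
  weight-nonNeg allDistinct (suc _) zero    = y≥0
  weight-nonNeg allDistinct zero    (suc _) = z≥0
  weight-nonNeg allDistinct zero    zero    = w≥0
  weight-nonNeg onePair     _       _       = ℚP.≤-refl
  weight-nonNeg allEqual    (suc _) _       = ℕ→ℚ-nonNeg (h₁ ℕ.* h₁)
  weight-nonNeg allEqual    zero    (suc _) = ℕ→ℚ-nonNeg (h₂ ℕ.* h₂)
  weight-nonNeg allEqual    zero    zero    = ℕ→ℚ-nonNeg (h₃ ℕ.* h₃)

  O : Fin (suc (suc m)) → Fin (suc (suc m)) → Fin (suc (suc m)) → ℚ
  O i j l = weight (shape (coincidences i j l)) (occurrences A i j l) (occurrences B i j l)

  O-cong : ∀ i j l i′ j′ l′ → coincidences i j l ≡ coincidences i′ j′ l′ →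
           occurrences A i j l ≡ occurrences A i′ j′ l′ →
           occurrences B i j l ≡ occurrences B i′ j′ l′ → O i j l ≡ O i′ j′ l′
  O-cong i j l i′ j′ l′ c≡ a≡ b≡ =
    trans (cong₂ (λ c a → weight (shape c) a (occurrences B i j l)) c≡ a≡)
          (cong (weight (shape (coincidences i′ j′ l′)) (occurrences A i′ j′ l′)) b≡)

  O-shape : ∀ i j l {c} → coincidences i j l ≡ c →
            O i j l ≡ weight (shape c) (occurrences A i j l) (occurrences B i j l)
  O-shape i j l = cong (λ c → weight (shape c) (occurrences A i j l) (occurrences B i j l))

  sym₁₂ : ∀ i j l → O i j l ≡ O j i l
  sym₁₂ i j l = O-cong i j l j i l
    (coincidences-swap₁₂ i j l) (occurrences-swap₁₂ A i j l) (occurrences-swap₁₂ B i j l)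

  sym₂₃ : ∀ i j l → O i j l ≡ O i l j
  sym₂₃ i j l = O-cong i j l i l j
    (coincidences-swap₂₃ i j l) (occurrences-swap₂₃ A i j l) (occurrences-swap₂₃ B i j l)

  offDiag : ∀ i j → i ≢ j → O i i j ≡ 0ℚ
  offDiag i j i≢j = O-shape i i j (coincidences-iij i≢j)

  diag : ∀ i → O i i i ≡ ℕ→ℚ (P i ℕ.* P i)
  diag i = trans (O-shape i i i (coincidences-iii i)) (diagonal-weight i)
    where
    diagonal-weight : ∀ i → weight allEqual (occurrences A i i i) (occurrences B i i i) ≡ ℕ→ℚ (P i ℕ.* P i)
    diagonal-weight A     = refl
    diagonal-weight B     = refl
    diagonal-weight (C _) = refl

  nonneg : ∀ i j l → 0ℚ ℚ.≤ O i j l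
  nonneg i j l = weight-nonNeg (shape (coincidences i j l)) (occurrences A i j l) (occurrences B i j l)

  O-distinct : ∀ i j l → i ≢ j → j ≢ l → i ≢ l →
               O i j l ≡ weight allDistinct (occurrences A i j l) (occurrences B i j l)
  O-distinct i j l i≢j j≢l i≢l = O-shape i j l (coincidences-distinct i≢j j≢l i≢l)

  open SymmetricArray {suc (suc m)} {O} sym₁₂ sym₂₃ offDiag

  C-≢ : ∀ {c d : Fin m} → c ≢ d → _≢_ {A = Fin (suc (suc m))} (C c) (C d)
  C-≢ c≢d refl = c≢d refl

  row-transpose : ∀ i j → sum (O j i) ≡ ℕ→ℚ (P j ℕ.* P i) → sum (O i j) ≡ ℕ→ℚ (P i ℕ.* P j)
  row-transpose i j row = trans (sum-cong-≗ (sym₁₂ i j)) (trans row (cong ℕ→ℚ (ℕP.*-comm (P j) (P i))))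

  diagonalRow : ∀ i → sum (O i i) ≡ ℕ→ℚ (P i ℕ.* P i)
  diagonalRow i = begin
    sum (O i i)                             ≡⟨ sum-constExcept (O i i) i (λ l l≢i → offDiag i l (≢-sym l≢i)) ⟩
    O i i i ℚ.+ ℕ→ℚ (suc m) ℚ.* 0ℚ          ≡⟨ cong (O i i i ℚ.+_) (ℚP.*-zeroʳ (ℕ→ℚ (suc m))) ⟩
    O i i i ℚ.+ 0ℚ                          ≡⟨ ℚP.+-identityʳ (O i i i) ⟩
    O i i i                                 ≡⟨ diag i ⟩
    ℕ→ℚ (P i ℕ.* P i)                       ∎
    where open ≡-Reasoning

  rowAB : sum (O A B) ≡ ℕ→ℚ (h₁ ℕ.* h₂)
  rowAB = begin
    0ℚ ℚ.+ (0ℚ ℚ.+ sum {m} (λ _ → x))      ≡⟨ 0+[0+p]≡p (sum {m} (λ _ → x)) ⟩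
    sum {m} (λ _ → x)                      ≡⟨ sum-const m x ⟩
    ℕ→ℚ m ℚ.* x                            ≡⟨ row₁₂ ⟩
    ℕ→ℚ (h₁ ℕ.* h₂)                        ∎
    where open ≡-Reasoning

  rowAC : ∀ c → sum (O A (C c)) ≡ ℕ→ℚ (h₁ ℕ.* h₃)
  rowAC c = begin
    0ℚ ℚ.+ (x ℚ.+ sum (λ d → O A (C c) (C d)))    ≡⟨ ℚP.+-identityˡ (x ℚ.+ sum (λ d → O A (C c) (C d))) ⟩
    x ℚ.+ sum (λ d → O A (C c) (C d))            ≡⟨ cong (x ℚ.+_) (sum-constExcept _ c y-off-c) ⟩
    x ℚ.+ (O A (C c) (C c) ℚ.+ ℕ→ℚ (suc n) ℚ.* y) ≡⟨ cong (λ t → x ℚ.+ (t ℚ.+ ℕ→ℚ (suc n) ℚ.* y)) (O-ijj≡0 A (C c) (λ ())) ⟩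
    x ℚ.+ (0ℚ ℚ.+ ℕ→ℚ (suc n) ℚ.* y)             ≡⟨ cong (x ℚ.+_) (ℚP.+-identityˡ (ℕ→ℚ (suc n) ℚ.* y)) ⟩
    x ℚ.+ ℕ→ℚ (suc n) ℚ.* y                      ≡⟨ row₁₃ ⟩
    ℕ→ℚ (h₁ ℕ.* h₃)                              ∎
    where
    open ≡-Reasoning
    y-off-c : ∀ d → d ≢ c → O A (C c) (C d) ≡ y
    y-off-c d d≢c = O-distinct A (C c) (C d) (λ ()) (C-≢ (≢-sym d≢c)) (λ ())

  rowBC : ∀ c → sum (O B (C c)) ≡ ℕ→ℚ (h₂ ℕ.* h₃)
  rowBC c = begin
    x ℚ.+ (0ℚ ℚ.+ sum (λ d → O B (C c) (C d)))    ≡⟨ cong (x ℚ.+_) (ℚP.+-identityˡ (sum (λ d → O B (C c) (C d)))) ⟩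
    x ℚ.+ sum (λ d → O B (C c) (C d))            ≡⟨ cong (x ℚ.+_) (sum-constExcept _ c z-off-c) ⟩
    x ℚ.+ (O B (C c) (C c) ℚ.+ ℕ→ℚ (suc n) ℚ.* z) ≡⟨ cong (λ t → x ℚ.+ (t ℚ.+ ℕ→ℚ (suc n) ℚ.* z)) (O-ijj≡0 B (C c) (λ ())) ⟩
    x ℚ.+ (0ℚ ℚ.+ ℕ→ℚ (suc n) ℚ.* z)             ≡⟨ cong (x ℚ.+_) (ℚP.+-identityˡ (ℕ→ℚ (suc n) ℚ.* z)) ⟩
    x ℚ.+ ℕ→ℚ (suc n) ℚ.* z                      ≡⟨ row₂₃ ⟩
    ℕ→ℚ (h₂ ℕ.* h₃)                              ∎
    where
    open ≡-Reasoning
    z-off-c : ∀ d → d ≢ c → O B (C c) (C d) ≡ z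
    z-off-c d d≢c = O-distinct B (C c) (C d) (λ ()) (C-≢ (≢-sym d≢c)) (λ ())

  rowCC : ∀ {c d} → c ≢ d → sum (O (C c) (C d)) ≡ ℕ→ℚ (h₃ ℕ.* h₃)
  rowCC {c} {d} c≢d = begin
    O (C c) (C d) A ℚ.+ (O (C c) (C d) B ℚ.+ sum (λ e → O (C c) (C d) (C e)))
      ≡⟨ cong₂ (λ s t → s ℚ.+ (t ℚ.+ sum (λ e → O (C c) (C d) (C e))))
               (O-distinct (C c) (C d) A Cc≢Cd (λ ()) (λ ())) (O-distinct (C c) (C d) B Cc≢Cd (λ ()) (λ ())) ⟩
    y ℚ.+ (z ℚ.+ sum (λ e → O (C c) (C d) (C e)))
      ≡⟨ cong (λ t → y ℚ.+ (z ℚ.+ t)) (sum-constExcept₂ _ c≢d w-off-cd) ⟩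
    y ℚ.+ (z ℚ.+ (O (C c) (C d) (C c) ℚ.+ (O (C c) (C d) (C d) ℚ.+ ℕ→ℚ n ℚ.* w)))
      ≡⟨ cong₂ (λ s t → y ℚ.+ (z ℚ.+ (s ℚ.+ (t ℚ.+ ℕ→ℚ n ℚ.* w))))
               (O-iji≡0 (C c) (C d) Cc≢Cd) (O-ijj≡0 (C c) (C d) Cc≢Cd) ⟩
    y ℚ.+ (z ℚ.+ (0ℚ ℚ.+ (0ℚ ℚ.+ ℕ→ℚ n ℚ.* w)))
      ≡⟨ cong (λ t → y ℚ.+ (z ℚ.+ t)) (0+[0+p]≡p (ℕ→ℚ n ℚ.* w)) ⟩
    y ℚ.+ (z ℚ.+ ℕ→ℚ n ℚ.* w)
      ≡⟨ row₃₃ ⟩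
    ℕ→ℚ (h₃ ℕ.* h₃) ∎
    where
    open ≡-Reasoning
    Cc≢Cd : C c ≢ C d
    Cc≢Cd = C-≢ c≢d
    w-off-cd : ∀ e → e ≢ c → e ≢ d → O (C c) (C d) (C e) ≡ w
    w-off-cd e e≢c e≢d = O-distinct (C c) (C d) (C e) Cc≢Cd (C-≢ (≢-sym e≢d)) (C-≢ (≢-sym e≢c))

  offDiagonalRow : ∀ i j → i ≢ j → sum (O i j) ≡ ℕ→ℚ (P i ℕ.* P j)
  offDiagonalRow A     A     A≢A   = contradiction refl A≢A
  offDiagonalRow A     B     _     = rowAB
  offDiagonalRow A     (C c) _     = rowAC c
  offDiagonalRow B     A     _     = row-transpose B A rowAB
  offDiagonalRow B     B     B≢B   = contradiction refl B≢B
  offDiagonalRow B     (C c) _     = rowBC c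
  offDiagonalRow (C c) A     _     = row-transpose (C c) A (rowAC c)
  offDiagonalRow (C c) B     _     = row-transpose (C c) B (rowBC c)
  offDiagonalRow (C c) (C d) Cc≢Cd = rowCC (Cc≢Cd ∘ cong (λ e → C e))

  row : ∀ i j → Dec (i ≡ j) → sum (O i j) ≡ ℕ→ℚ (P i ℕ.* P j)
  row i _ (yes refl) = diagonalRow i
  row i j (no i≢j)   = offDiagonalRow i j i≢j

  rowSum : ∀ i j → ∑ (O i j) ≡ ℕ→ℚ (P i ℕ.* P j)
  rowSum i j = trans (∑≡sum (O i j)) (row i j (i ≟ j))

  ros : ROS P
  ros = record
    { O = O ; sym₁₂ = sym₁₂ ; sym₂₃ = sym₂₃ ; nonneg = nonneg
    ; rowSum = rowSum ; diag = diag ; offDiag = offDiag }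

module BlockSums {m h₁ h₂ h₃ : ℕ} (R : ROS (seq3 h₁ h₂ h₃ m)) where
  open ROS R
  open SymmetricArray {suc (suc m)} {O} sym₁₂ sym₂₃ offDiag

  μ H₁₂ H₁₃ H₂₃ H₃₃ : ℚ
  μ   = ℕ→ℚ m
  H₁₂ = ℕ→ℚ (h₁ ℕ.* h₂)
  H₁₃ = ℕ→ℚ (h₁ ℕ.* h₃)
  H₂₃ = ℕ→ℚ (h₂ ℕ.* h₃)
  H₃₃ = ℕ→ℚ (h₃ ℕ.* h₃)

  S₁₂₃ S₁₃₃ S₂₃₃ S₃₃₃ : ℚ
  S₁₂₃ = sum λ c → O A B (C c)
  S₁₃₃ = sum λ c → sum λ d → O A (C c) (C d)
  S₂₃₃ = sum λ c → sum λ d → O B (C c) (C d)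
  S₃₃₃ = sum λ c → sum λ d → sum λ e → O (C c) (C d) (C e)

  row : ∀ i j → O i j A ℚ.+ (O i j B ℚ.+ sum (λ c → O i j (C c)))
              ≡ ℕ→ℚ (seq3 h₁ h₂ h₃ m i ℕ.* seq3 h₁ h₂ h₃ m j)
  row i j = trans (sym (∑≡sum (O i j))) (rowSum i j)

  S₁₂₃≡H₁₂ : S₁₂₃ ≡ H₁₂
  S₁₂₃≡H₁₂ = begin
    S₁₂₃                                ≡⟨ 0+[0+p]≡p S₁₂₃ ⟨
    0ℚ ℚ.+ (0ℚ ℚ.+ S₁₂₃)                ≡⟨ cong₂ (λ s t → s ℚ.+ (t ℚ.+ S₁₂₃)) (O-iji≡0 A B (λ ())) (O-ijj≡0 A B (λ ())) ⟨
    O A B A ℚ.+ (O A B B ℚ.+ S₁₂₃)       ≡⟨ row A B ⟩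
    H₁₂                                 ∎
    where open ≡-Reasoning

  S₁₂₃+S₁₃₃ : S₁₂₃ ℚ.+ S₁₃₃ ≡ μ ℚ.* H₁₃
  S₁₂₃+S₁₃₃ = begin
    S₁₂₃ ℚ.+ S₁₃₃                                              ≡⟨ ∑-distrib-+ (λ c → O A B (C c)) _ ⟨
    sum (λ c → O A B (C c) ℚ.+ sum (λ d → O A (C c) (C d)))    ≡⟨ sum-cong-≗ {m} row₁₃ ⟩
    sum {m} (λ _ → H₁₃)                                        ≡⟨ sum-const m H₁₃ ⟩
    μ ℚ.* H₁₃                                                  ∎
    where
    open ≡-Reasoning
    row₁₃ : ∀ c → O A B (C c) ℚ.+ sum (λ d → O A (C c) (C d)) ≡ H₁₃
    row₁₃ c = begin
      O A B (C c) ℚ.+ s                         ≡⟨ cong (ℚ._+ s) (sym₂₃ A B (C c)) ⟩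
      O A (C c) B ℚ.+ s                         ≡⟨ ℚP.+-identityˡ (O A (C c) B ℚ.+ s) ⟨
      0ℚ ℚ.+ (O A (C c) B ℚ.+ s)                ≡⟨ cong (ℚ._+ (O A (C c) B ℚ.+ s)) (O-iji≡0 A (C c) (λ ())) ⟨
      O A (C c) A ℚ.+ (O A (C c) B ℚ.+ s)       ≡⟨ row A (C c) ⟩
      H₁₃                                       ∎
      where
      s : ℚ
      s = sum (λ d → O A (C c) (C d))

  S₁₂₃+S₂₃₃ : S₁₂₃ ℚ.+ S₂₃₃ ≡ μ ℚ.* H₂₃
  S₁₂₃+S₂₃₃ = begin
    S₁₂₃ ℚ.+ S₂₃₃                                              ≡⟨ ∑-distrib-+ (λ c → O A B (C c)) _ ⟨
    sum (λ c → O A B (C c) ℚ.+ sum (λ d → O B (C c) (C d)))    ≡⟨ sum-cong-≗ {m} row₂₃ ⟩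
    sum {m} (λ _ → H₂₃)                                        ≡⟨ sum-const m H₂₃ ⟩
    μ ℚ.* H₂₃                                                  ∎
    where
    open ≡-Reasoning
    row₂₃ : ∀ c → O A B (C c) ℚ.+ sum (λ d → O B (C c) (C d)) ≡ H₂₃
    row₂₃ c = begin
      O A B (C c) ℚ.+ s                         ≡⟨ cong (ℚ._+ s) (rotate A B (C c)) ⟩
      O B (C c) A ℚ.+ s                         ≡⟨ cong (O B (C c) A ℚ.+_) (ℚP.+-identityˡ s) ⟨
      O B (C c) A ℚ.+ (0ℚ ℚ.+ s)                ≡⟨ cong (λ t → O B (C c) A ℚ.+ (t ℚ.+ s)) (O-iji≡0 B (C c) (λ ())) ⟨
      O B (C c) A ℚ.+ (O B (C c) B ℚ.+ s)       ≡⟨ row B (C c) ⟩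
      H₂₃                                       ∎
      where
      s : ℚ
      s = sum (λ d → O B (C c) (C d))

  S₁₃₃+S₂₃₃+S₃₃₃ : S₁₃₃ ℚ.+ (S₂₃₃ ℚ.+ S₃₃₃) ≡ μ ℚ.* (μ ℚ.* H₃₃)
  S₁₃₃+S₂₃₃+S₃₃₃ = begin
    S₁₃₃ ℚ.+ (S₂₃₃ ℚ.+ S₃₃₃)                               ≡⟨ ∑-distrib-+₃ (sum ∘ a) (sum ∘ b) (sum ∘ t) ⟨
    sum (λ c → sum (a c) ℚ.+ (sum (b c) ℚ.+ sum (t c)))    ≡⟨ sum-cong-≗ {m} (λ c → ∑-distrib-+₃ (a c) (b c) (t c)) ⟨
    sum (λ c → sum λ d → a c d ℚ.+ (b c d ℚ.+ t c d))      ≡⟨ sum-cong-≗ {m} (λ c → sum-cong-≗ {m} (row₃₃ c)) ⟩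
    sum {m} (λ _ → sum {m} (λ _ → H₃₃))                    ≡⟨ sum-cong-≗ {m} (λ _ → sum-const m H₃₃) ⟩
    sum {m} (λ _ → μ ℚ.* H₃₃)                              ≡⟨ sum-const m (μ ℚ.* H₃₃) ⟩
    μ ℚ.* (μ ℚ.* H₃₃)                                      ∎
    where
    open ≡-Reasoning
    a b t : Fin m → Fin m → ℚ
    a c d = O A (C c) (C d)
    b c d = O B (C c) (C d)
    t c d = sum λ e → O (C c) (C d) (C e)
    row₃₃ : ∀ c d → a c d ℚ.+ (b c d ℚ.+ t c d) ≡ H₃₃
    row₃₃ c d = trans (cong₂ (λ p q → p ℚ.+ (q ℚ.+ t c d)) (rotate A (C c) (C d)) (rotate B (C c) (C d)))
                      (row (C c) (C d))

  S₁₃₃≥0 : 0ℚ ℚ.≤ S₁₃₃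
  S₁₃₃≥0 = sum-nonNeg λ c → sum-nonNeg λ d → nonneg A (C c) (C d)

  S₂₃₃≥0 : 0ℚ ℚ.≤ S₂₃₃
  S₂₃₃≥0 = sum-nonNeg λ c → sum-nonNeg λ d → nonneg B (C c) (C d)

  μH₃₃≤S₃₃₃ : μ ℚ.* H₃₃ ℚ.≤ S₃₃₃
  μH₃₃≤S₃₃₃ = begin
    μ ℚ.* H₃₃                              ≡⟨ sum-const m H₃₃ ⟨
    sum {m} (λ _ → H₃₃)                    ≡⟨ sum-cong-≗ {m} (λ c → diag (C c)) ⟨
    sum (λ c → O (C c) (C c) (C c))        ≤⟨ sum-mono-≤ diagonal≤ ⟩
    S₃₃₃                                   ∎
    where
    open ℚP.≤-Reasoning
    diagonal≤ : ∀ c → O (C c) (C c) (C c) ℚ.≤ sum λ d → sum λ e → O (C c) (C d) (C e)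
    diagonal≤ c = ℚP.≤-trans (term≤sum (λ e → nonneg (C c) (C c) (C e)) c)
                             (term≤sum (λ d → sum-nonNeg λ e → nonneg (C c) (C d) (C e)) c)

module Averaged (k h₁ h₂ h₃ : ℕ) where
  m : ℕ
  m = 3 ℕ.+ k

  μ ν κ H₁₂ H₁₃ H₂₃ H₃₃ : ℚ
  μ   = ℕ→ℚ m
  ν   = ℕ→ℚ (m ∸ 1)
  κ   = ℕ→ℚ (m ∸ 2)
  H₁₂ = ℕ→ℚ (h₁ ℕ.* h₂)
  H₁₃ = ℕ→ℚ (h₁ ℕ.* h₃)
  H₂₃ = ℕ→ℚ (h₂ ℕ.* h₃)
  H₃₃ = ℕ→ℚ (h₃ ℕ.* h₃)

  Q : ℚ
  Q = (H₃₃ ℚ.- (+ h₃ / (m ∸ 1)) ℚ.* ℕ→ℚ (h₁ ℕ.+ h₂)) ℚ.+ (+ 2 / (m ℕ.* (m ∸ 1))) ℚ.* H₁₂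

  -- For an ROS the block sums S₁₃₃, S₂₃₃ and S₃₃₃ - μ H₃₃ are μν ȳ, μν z̄ and μν Q:
  -- x̄, ȳ, z̄, w̄ are its averages over the orbits of the permutations of the h₃-block.
  x̄ : ℚ
  x̄ = H₁₂ ℚ.* (+ 1 / m)

  share : ℚ → ℚ
  share H = (H ℚ.- x̄) ℚ.* (+ 1 / (m ∸ 1))

  ȳ z̄ w̄ : ℚ
  ȳ = share H₁₃
  z̄ = share H₂₃
  w̄ = Q ℚ.* (+ 1 / (m ∸ 2))

  μx̄≡H₁₂ : μ ℚ.* x̄ ≡ H₁₂
  μx̄≡H₁₂ = *-1/-cancel m H₁₂

  x̄+ν*share : ∀ H → x̄ ℚ.+ ν ℚ.* share H ≡ H
  x̄+ν*share H = trans (cong (x̄ ℚ.+_) (*-1/-cancel (m ∸ 1) (H ℚ.- x̄))) (p+[q-p]≡q x̄ H)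
    where
    p+[q-p]≡q : ∀ p q → p ℚ.+ (q ℚ.- p) ≡ q
    p+[q-p]≡q = solve 2 (λ p q → p :+ (q :- p) := q) refl

  μν*share : ∀ H → μ ℚ.* (ν ℚ.* share H) ≡ μ ℚ.* H ℚ.- H₁₂
  μν*share H = begin
    μ ℚ.* (ν ℚ.* share H)     ≡⟨ cong (μ ℚ.*_) (*-1/-cancel (m ∸ 1) (H ℚ.- x̄)) ⟩
    μ ℚ.* (H ℚ.- x̄)           ≡⟨ p[q-r]≡pq-pr μ H x̄ ⟩
    μ ℚ.* H ℚ.- μ ℚ.* x̄       ≡⟨ cong (λ t → μ ℚ.* H ℚ.- t) μx̄≡H₁₂ ⟩
    μ ℚ.* H ℚ.- H₁₂           ∎
    where
    open ≡-Reasoning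
    p[q-r]≡pq-pr : ∀ p q r → p ℚ.* (q ℚ.- r) ≡ p ℚ.* q ℚ.- p ℚ.* r
    p[q-r]≡pq-pr = solve 3 (λ p q r → p :* (q :- r) := p :* q :- p :* r) refl

  ȳ+z̄+Q≡H₃₃ : ȳ ℚ.+ (z̄ ℚ.+ Q) ≡ H₃₃
  ȳ+z̄+Q≡H₃₃ = row₃₃-identity (ℕ→ℚ h₁) (ℕ→ℚ h₂) (ℕ→ℚ h₃) H₁₂ H₃₃ (+ 1 / m) (+ 1 / (m ∸ 1))
    (ℕ→ℚ-* h₁ h₃) (ℕ→ℚ-* h₂ h₃) (ℕ→ℚ-+ h₁ h₂) (/-split h₃ (m ∸ 1))
    (trans (/-split 2 (m ℕ.* (m ∸ 1))) (cong (ℕ→ℚ 2 ℚ.*_) (1/-* m (m ∸ 1))))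
    where
    row₃₃-identity : ∀ {H₁₃ H₂₃ S α β} H₁ H₂ H₃ P H r₁ r₂ →
               H₁₃ ≡ H₁ ℚ.* H₃ → H₂₃ ≡ H₂ ℚ.* H₃ → S ≡ H₁ ℚ.+ H₂ →
               α ≡ H₃ ℚ.* r₂ → β ≡ ℕ→ℚ 2 ℚ.* (r₁ ℚ.* r₂) →
               (H₁₃ ℚ.- P ℚ.* r₁) ℚ.* r₂ ℚ.+ ((H₂₃ ℚ.- P ℚ.* r₁) ℚ.* r₂ ℚ.+ ((H ℚ.- α ℚ.* S) ℚ.+ β ℚ.* P)) ≡ H
    row₃₃-identity H₁ H₂ H₃ P H r₁ r₂ refl refl refl refl refl = solve 7
      (λ H₁ H₂ H₃ P H r₁ r₂ →
         (H₁ :* H₃ :- P :* r₁) :* r₂ :+ ((H₂ :* H₃ :- P :* r₁) :* r₂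
           :+ ((H :- (H₃ :* r₂) :* (H₁ :+ H₂)) :+ (con (ℕ→ℚ 2) :* (r₁ :* r₂)) :* P)) := H)
      refl H₁ H₂ H₃ P H r₁ r₂

  ȳ+z̄+κw̄≡H₃₃ : ȳ ℚ.+ (z̄ ℚ.+ κ ℚ.* w̄) ≡ H₃₃
  ȳ+z̄+κw̄≡H₃₃ = trans (cong (λ t → ȳ ℚ.+ (z̄ ℚ.+ t)) (*-1/-cancel (m ∸ 2) Q)) ȳ+z̄+Q≡H₃₃

  μνQ : μ ℚ.* (ν ℚ.* Q) ≡ μ ℚ.* (ν ℚ.* H₃₃) ℚ.- ((μ ℚ.* H₁₃ ℚ.- H₁₂) ℚ.+ (μ ℚ.* H₂₃ ℚ.- H₁₂))
  μνQ = begin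
    μ ℚ.* (ν ℚ.* Q)
      ≡⟨ cong (λ q → μ ℚ.* (ν ℚ.* q)) (p+q≡r⇒q≡r-p (trans (ℚP.+-assoc ȳ z̄ Q) ȳ+z̄+Q≡H₃₃)) ⟩
    μ ℚ.* (ν ℚ.* (H₃₃ ℚ.- (ȳ ℚ.+ z̄)))
      ≡⟨ distribute μ ν H₃₃ ȳ z̄ ⟩
    μ ℚ.* (ν ℚ.* H₃₃) ℚ.- (μ ℚ.* (ν ℚ.* ȳ) ℚ.+ μ ℚ.* (ν ℚ.* z̄))
      ≡⟨ cong₂ (λ s t → μ ℚ.* (ν ℚ.* H₃₃) ℚ.- (s ℚ.+ t)) (μν*share H₁₃) (μν*share H₂₃) ⟩
    μ ℚ.* (ν ℚ.* H₃₃) ℚ.- ((μ ℚ.* H₁₃ ℚ.- H₁₂) ℚ.+ (μ ℚ.* H₂₃ ℚ.- H₁₂))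
      ∎
    where
    open ≡-Reasoning
    distribute : ∀ a b h y z → a ℚ.* (b ℚ.* (h ℚ.- (y ℚ.+ z))) ≡ a ℚ.* (b ℚ.* h) ℚ.- (a ℚ.* (b ℚ.* y) ℚ.+ a ℚ.* (b ℚ.* z))
    distribute = solve 5
      (λ a b h y z → a :* (b :* (h :- (y :+ z))) := a :* (b :* h) :- (a :* (b :* y) :+ a :* (b :* z))) refl

  averagedSolution : H₁₂ ℚ.≤ μ ℚ.* H₁₃ → H₁₂ ℚ.≤ μ ℚ.* H₂₃ → 0ℚ ℚ.≤ Q →
                     SymmetricSolution (suc k) h₁ h₂ h₃
  averagedSolution H₁₂≤μH₁₃ H₁₂≤μH₂₃ 0≤Q = record
    { x = x̄ ; y = ȳ ; z = z̄ ; w = w̄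
    ; x≥0 = 0≤[1+n]*q⇒0≤q (2 ℕ.+ k) (subst (0ℚ ℚ.≤_) (sym μx̄≡H₁₂) (ℕ→ℚ-nonNeg (h₁ ℕ.* h₂)))
    ; y≥0 = share-nonNeg H₁₂≤μH₁₃
    ; z≥0 = share-nonNeg H₁₂≤μH₂₃
    ; w≥0 = 0≤[1+n]*q⇒0≤q k (subst (0ℚ ℚ.≤_) (sym (*-1/-cancel (m ∸ 2) Q)) 0≤Q)
    ; row₁₂ = μx̄≡H₁₂
    ; row₁₃ = x̄+ν*share H₁₃
    ; row₂₃ = x̄+ν*share H₂₃
    ; row₃₃ = ȳ+z̄+κw̄≡H₃₃
    }
    where
    share-nonNeg : ∀ {H} → H₁₂ ℚ.≤ μ ℚ.* H → 0ℚ ℚ.≤ share H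
    share-nonNeg {H} H₁₂≤μH = 0≤[1+n]*q⇒0≤q (suc k) (0≤[1+n]*q⇒0≤q (2 ℕ.+ k)
      (subst (0ℚ ℚ.≤_) (sym (μν*share H)) (p≤q⇒0≤q-p H₁₂≤μH)))

  module _ (R : ROS (seq3 h₁ h₂ h₃ m)) where
    open BlockSums R using (S₁₂₃; S₁₃₃; S₂₃₃; S₃₃₃; S₁₂₃≡H₁₂; S₁₂₃+S₁₃₃; S₁₂₃+S₂₃₃;
                            S₁₃₃+S₂₃₃+S₃₃₃; S₁₃₃≥0; S₂₃₃≥0; μH₃₃≤S₃₃₃)

    ros⇒H₁₂≤μH₁₃ : H₁₂ ℚ.≤ μ ℚ.* H₁₃
    ros⇒H₁₂≤μH₁₃ = subst₂ ℚ._≤_ S₁₂₃≡H₁₂ S₁₂₃+S₁₃₃ (p≤p+q S₁₃₃≥0)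

    ros⇒H₁₂≤μH₂₃ : H₁₂ ℚ.≤ μ ℚ.* H₂₃
    ros⇒H₁₂≤μH₂₃ = subst₂ ℚ._≤_ S₁₂₃≡H₁₂ S₁₂₃+S₂₃₃ (p≤p+q S₂₃₃≥0)

    μνQ≡S₃₃₃-μH₃₃ : μ ℚ.* (ν ℚ.* Q) ≡ S₃₃₃ ℚ.- μ ℚ.* H₃₃
    μνQ≡S₃₃₃-μH₃₃ = begin
      μ ℚ.* (ν ℚ.* Q)
        ≡⟨ μνQ ⟩
      μ ℚ.* (ν ℚ.* H₃₃) ℚ.- ((μ ℚ.* H₁₃ ℚ.- H₁₂) ℚ.+ (μ ℚ.* H₂₃ ℚ.- H₁₂))
        ≡⟨ cong₂ (λ s t → μ ℚ.* (ν ℚ.* H₃₃) ℚ.- (s ℚ.+ t)) (S≡μH-H₁₂ S₁₂₃+S₁₃₃) (S≡μH-H₁₂ S₁₂₃+S₂₃₃) ⟨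
      μ ℚ.* (ν ℚ.* H₃₃) ℚ.- (S₁₃₃ ℚ.+ S₂₃₃)
        ≡⟨ μνh-s≡μμh-s-μh ν H₃₃ (S₁₃₃ ℚ.+ S₂₃₃) (ℕ→ℚ-suc (2 ℕ.+ k)) ⟩
      μ ℚ.* (μ ℚ.* H₃₃) ℚ.- (S₁₃₃ ℚ.+ S₂₃₃) ℚ.- μ ℚ.* H₃₃
        ≡⟨ cong (ℚ._- μ ℚ.* H₃₃) (p+q≡r⇒q≡r-p (trans (ℚP.+-assoc S₁₃₃ S₂₃₃ S₃₃₃) S₁₃₃+S₂₃₃+S₃₃₃)) ⟨
      S₃₃₃ ℚ.- μ ℚ.* H₃₃
        ∎
      where
      open ≡-Reasoning
      S≡μH-H₁₂ : ∀ {S H} → S₁₂₃ ℚ.+ S ≡ μ ℚ.* H → S ≡ μ ℚ.* H ℚ.- H₁₂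
      S≡μH-H₁₂ {S} {H} eq = trans (p+q≡r⇒q≡r-p eq) (cong (λ t → μ ℚ.* H ℚ.- t) S₁₂₃≡H₁₂)
      μνh-s≡μμh-s-μh : ∀ {μ} ν h s → μ ≡ 1ℚ ℚ.+ ν → μ ℚ.* (ν ℚ.* h) ℚ.- s ≡ μ ℚ.* (μ ℚ.* h) ℚ.- s ℚ.- μ ℚ.* h
      μνh-s≡μμh-s-μh ν h s refl = solve 3 (λ ν h s →
        (con 1ℚ :+ ν) :* (ν :* h) :- s := (con 1ℚ :+ ν) :* ((con 1ℚ :+ ν) :* h) :- s :- (con 1ℚ :+ ν) :* h) refl ν h s

    ros⇒0≤Q : 0ℚ ℚ.≤ Q
    ros⇒0≤Q = 0≤[1+n]*q⇒0≤q (suc k) (0≤[1+n]*q⇒0≤q (2 ℕ.+ k)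
      (subst (0ℚ ℚ.≤_) (sym μνQ≡S₃₃₃-μH₃₃) (p≤q⇒0≤q-p μH₃₃≤S₃₃₃)))

  necessary : 0 ℕ.< h₁ → 0 ℕ.< h₂ → ROS (seq3 h₁ h₂ h₃ m) →
              h₁ ≤ m ℕ.* h₃ × h₂ ≤ m ℕ.* h₃ × 0ℚ ℚ.≤ Q
  necessary 0<h₁ 0<h₂ R = Equivalence.from (≤⇔ℕ→ℚ-scaled′ h₁ h₂ h₃ m 0<h₂) (ros⇒H₁₂≤μH₂₃ R)
                        , Equivalence.from (≤⇔ℕ→ℚ-scaled h₁ h₂ h₃ m 0<h₁) (ros⇒H₁₂≤μH₁₃ R)
                        , ros⇒0≤Q R

  sufficient : 0 ℕ.< h₁ → 0 ℕ.< h₂ → h₁ ≤ m ℕ.* h₃ × h₂ ≤ m ℕ.* h₃ × 0ℚ ℚ.≤ Q →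
               ROS (seq3 h₁ h₂ h₃ m)
  sufficient 0<h₁ 0<h₂ (h₁≤mh₃ , h₂≤mh₃ , 0≤Q) = SymmetricConstruction.ros (averagedSolution
    (Equivalence.to (≤⇔ℕ→ℚ-scaled h₁ h₂ h₃ m 0<h₁) h₂≤mh₃)
    (Equivalence.to (≤⇔ℕ→ℚ-scaled′ h₁ h₂ h₃ m 0<h₂) h₁≤mh₃)
    0≤Q)

mainTheorem5 : (m h₁ h₂ h₃ : ℕ) → (hm : 3 ≤ m) →
    1 ≤ h₁ → 1 ≤ h₂ → 1 ≤ h₃ →
    ROS (seq3 h₁ h₂ h₃ m)
      ⇔ (h₁ ≤ m ℕ.* h₃ × h₂ ≤ m ℕ.* h₃ ×
         0ℚ ℚ.≤ ((ℕ→ℚ (h₃ ℕ.* h₃)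
                  ℚ.- ((+ h₃ / (m ∸ 1)) {{nz-m-1 hm}}) ℚ.* ℕ→ℚ (h₁ ℕ.+ h₂))
                  ℚ.+ ((+ 2 / (m ℕ.* (m ∸ 1))) {{nz-mm-1 hm}}) ℚ.* ℕ→ℚ (h₁ ℕ.* h₂)))
mainTheorem5 (suc (suc (suc k))) h₁ h₂ h₃ (s≤s (s≤s (s≤s _))) 0<h₁ 0<h₂ _ =
  mk⇔ (necessary 0<h₁ 0<h₂) (sufficient 0<h₁ 0<h₂)
  where open Averaged k h₁ h₂ h₃
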